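{- Let $\gamma,\rho$ be coprime positive integers with $\gamma<\rho$, $N=\gamma+\rho$, and $\gamma^*\in\{1,\ldots,N-1\}$ the inverse of $\gamma$ modulo $N$. Let $\sigma$ be the permutation $x\mapsto x+\rho\bmod N$ of $\{0,\ldots,N-1\}$ and for $n=N-1,\ldots,N-\gamma-1$ put $i=N-1-n$, let $\sigma_n$ be the cyclic restriction of $\sigma$ to $\{0,\ldots,n\}$, and let $v_n=\ell_i(0)\ell_i(\sigma_n(0))\cdots\ell_i(\sigma_n^{n}(0))$, where $\ell_i(x)=a$ if $x<\gamma-i$, $b$ if $\gamma-i\le x<\gamma$, $c$ if $x\ge\gamma$. For $i=1,\ldots,\gamma$ let $d_i$ be the number of $j\in\{1,\ldots,i\}$ with $j\gamma^*\bmod N$ smaller than $i\gamma^*\bmod N$, and $e_i=(i\gamma^*\bmod N)-d_i$. Then for $n=N-2,\ldots,N-\gamma-1$ (with $i=N-1-n$), writing $v_{n+1}=a_0\cdots a_k$, we have $a_{e_i-1}=a$, $a_{e_i}=c$ and $v_n=a_0\cdots a_{e_i-2}\,b\,a_{e_i+1}\cdots a_k$.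
   Context: Positions are indexed from $0$. The cyclic restriction of a permutation $\sigma$ of $\{0,\ldots,N-1\}$ to $\{0,\ldots,k-1\}$ is the permutation of $\{0,\ldots,k-1\}$ obtained by deleting, in a cycle decomposition of $\sigma$, all numbers $\ge k$. -}

module Defs where

open import Data.Nat using (ℕ; zero; suc; _+_; _*_; _∸_; _<ᵇ_; _<?_; _%_)
open import Data.Bool using (if_then_else_)
open import Data.List using (List; []; _∷_; map; filter; upTo; length; iterate)
open import Data.Maybe using (Maybe; just; nothing)

-- x mod N (N is always positive where used; the zero case is junk)
_mod_ : ℕ → ℕ → ℕ
x mod zero    = x
x mod (suc m) = x % suc m

σ : (γ ρ : ℕ) → ℕ → ℕ
σ γ ρ x = (x + ρ) mod (γ + ρ)

-- first return of the orbit of y under f to {0,…,k-1}, searching at most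
-- 'fuel' steps.  For a permutation f of {0,…,N-1}, fuel N always suffices.
firstReturn : ℕ → (ℕ → ℕ) → ℕ → ℕ → ℕ
firstReturn zero       f k y = y
firstReturn (suc fuel) f k y =
  if f y <ᵇ k then f y else firstReturn fuel f k (f y)

-- cyclic restriction to {0,…,k-1} of a permutation f of {0,…,N-1}:
-- deleting the numbers ≥ k in the cycle decomposition of f means sending
-- x < k to the first element of its forward orbit (after x) that is < k.
cyclicRestriction : (N : ℕ) → (ℕ → ℕ) → (k : ℕ) → ℕ → ℕ
cyclicRestriction N f k = firstReturn N f k

σₙ : (γ ρ n : ℕ) → ℕ → ℕ
σₙ γ ρ n = cyclicRestriction (γ + ρ) (σ γ ρ) (suc n)

data Letter : Set where
  a b c : Letter

ℓ : (γ i x : ℕ) → Letter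
ℓ γ i x = if x <ᵇ γ ∸ i then a else (if x <ᵇ γ then b else c)

v : (γ ρ n : ℕ) → List Letter
v γ ρ n = map (ℓ γ (γ + ρ ∸ 1 ∸ n)) (iterate (σₙ γ ρ n) 0 (suc n))

d : (γ ρ γ* i : ℕ) → ℕ
d γ ρ γ* i =
  length (filter (λ j → ((j * γ*) mod (γ + ρ)) <? ((i * γ*) mod (γ + ρ)))
                 (map suc (upTo i)))

e : (γ ρ γ* i : ℕ) → ℕ
e γ ρ γ* i = ((i * γ*) mod (γ + ρ)) ∸ d γ ρ γ* i

_!_ : {A : Set} → List A → ℕ → Maybe A
[]       ! _     = nothing
(x ∷ xs) ! zero  = just x
(x ∷ xs) ! suc m = xs ! m

-- The orbit of 0 under σ is p ↦ pρ mod N, and σ_n lists the orbit points ≤ n in orbit order, so v_n is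
-- that orbit filtered below n + 1 and coloured by ℓ_i.  Going from v (n+1) to v n deletes the point
-- w = n + 1 = N − i and lowers the a/b threshold by one, which recolours only u = γ − i, from a to b.
-- Since w = u + ρ, the orbit visits u and w at consecutive times k and k + 1 = iγ* mod N (it is at −j
-- at time jγ*), so the deleted c directly follows that a.  The orbit points ≤ w visited before time k
-- number k minus the times p < k with orbit p > w, and p = jγ* mod N matches those times with the
-- j < i having jγ* mod N < k, of which there are d_i.  Hence the a is at position k − d_i = e_i − 1.

module Submission where

open import Defs
open import Data.Nat using (ℕ; suc; _+_; _*_; _∸_; _<_; _≤_)
open import Data.Nat.Coprimality using (Coprime)
open import Data.List using (_++_; _∷_; take; drop)
open import Data.Maybe using (just)
open import Data.Product using (_×_)
open import Relation.Binary.PropositionalEquality using (_≡_)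

open import Data.Bool using (Bool; true; false; not)
open import Data.Empty using (⊥-elim)
open import Data.List using (List; []; [_]; length; map; filter; iterate; applyUpTo; upTo)
open import Data.List.Properties
  using (applyUpTo-∷ʳ; filter-++; length-++; filter-accept; filter-reject; take-all; ∷-injective; map-++; map-cong-local; map-upTo; length-map)
open import Data.List.Relation.Unary.All as All using (All; []; _∷_)
open import Data.List.Relation.Unary.All.Properties using (applyUpTo⁺₁; filter⁺)
open import Data.Nat
open import Data.Nat.DivMod hiding (_mod_)
open import Data.Nat.Properties
open import Data.Nat.Solver using (module +-*-Solver)
open import Data.Product using (∃-syntax; _,_; proj₁; proj₂)
open import Data.Sum using (inj₁; inj₂)
open import Function using (_∘_; case_of_)
open import Relation.Binary.Definitions using (tri<; tri≈; tri>)
open import Relation.Binary.PropositionalEquality hiding ([_])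
open import Relation.Nullary using (Dec; does; yes; no; ¬?)
open import Relation.Nullary.Decidable using (dec-true; dec-false)
open import Relation.Unary using (Decidable)
open +-*-Solver
open import Algebra.Properties.CommutativeSemigroup +-commutativeSemigroup using (interchange)

dec-true⁻¹ : ∀ {A : Set} (a? : Dec A) → does a? ≡ true → A
dec-true⁻¹ (yes x) _ = x

indicator : Bool → ℕ
indicator true  = 1
indicator false = 0

count : (ℕ → Bool) → ℕ → ℕ
count P zero    = 0
count P (suc m) = count P m + indicator (P m)

count-cong : ∀ {P Q} m → (∀ q → q < m → P q ≡ Q q) → count P m ≡ count Q m
count-cong zero    _   = refl
count-cong (suc m) P≡Q =
  cong₂ _+_ (count-cong m (λ q → P≡Q q ∘ m<n⇒m<1+n)) (cong indicator (P≡Q m ≤-refl))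

count-none : ∀ P m → (∀ q → q < m → P q ≡ false) → count P m ≡ 0
count-none P zero    _    = refl
count-none P (suc m) none rewrite none m ≤-refl =
  trans (+-identityʳ _) (count-none P m (λ q → none q ∘ m<n⇒m<1+n))

count-all : ∀ P m → (∀ q → q < m → P q ≡ true) → count P m ≡ m
count-all P zero    _   = refl
count-all P (suc m) all rewrite all m ≤-refl =
  trans (+-comm _ 1) (cong suc (count-all P m (λ q → all q ∘ m<n⇒m<1+n)))

count+count-not : ∀ P m → count P m + count (not ∘ P) m ≡ m
count+count-not P zero    = refl
count+count-not P (suc m) with P m
... | true  = trans (solve 2 (λ x y → x :+ con 1 :+ (y :+ con 0) := con 1 :+ (x :+ y)) refl (count P m) _)
                    (cong suc (count+count-not P m))
... | false = trans (solve 2 (λ x y → x :+ con 0 :+ (y :+ con 1) := con 1 :+ (x :+ y)) refl (count P m) _)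
                    (cong suc (count+count-not P m))

count-unique : ∀ P m t → t < m → P t ≡ true → (∀ q → q < m → P q ≡ true → q ≡ t) → count P m ≡ 1
count-unique P (suc m) t t≤m Pt unique with m≤n⇒m<n∨m≡n (s≤s⁻¹ t≤m)
... | inj₁ t<m = cong₂ _+_ (count-unique P m t t<m Pt (λ q → unique q ∘ m<n⇒m<1+n)) (cong indicator Pm≡false)
  where
  Pm≡false : P m ≡ false
  Pm≡false with P m in Pm
  ... | true  = ⊥-elim (<-irrefl (sym (unique m ≤-refl Pm)) t<m)
  ... | false = refl
... | inj₂ refl rewrite Pt = cong (_+ 1) (count-none P t none)
  where
  none : ∀ q → q < t → P q ≡ false
  none q q<t with P q in Pq
  ... | true  = ⊥-elim (<-irrefl (unique q (m<n⇒m<1+n q<t) Pq) q<t)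
  ... | false = refl

count-+ : ∀ P Q R m → (∀ q → q < m → indicator (P q) ≡ indicator (Q q) + indicator (R q)) →
          count P m ≡ count Q m + count R m
count-+ P Q R zero    _     = refl
count-+ P Q R (suc m) split = begin
  count P m + indicator (P m)
    ≡⟨ cong₂ _+_ (count-+ P Q R m (λ q → split q ∘ m<n⇒m<1+n)) (split m ≤-refl) ⟩
  count Q m + count R m + (indicator (Q m) + indicator (R m))
    ≡⟨ interchange (count Q m) _ _ _ ⟩
  count Q m + indicator (Q m) + (count R m + indicator (R m)) ∎
  where open ≡-Reasoning

indicator-<-suc : ∀ x K → indicator (does (x <? suc K)) ≡ indicator (does (x <? K)) + indicator (does (x ≟ K))
indicator-<-suc x K with <-cmp x K
... | tri< x<K x≢K _ rewrite dec-true (x <? suc K) (m<n⇒m<1+n x<K) | dec-true (x <? K) x<K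
                           | dec-false (x ≟ K) x≢K = refl
... | tri≈ _ refl _  rewrite dec-true (x <? suc x) ≤-refl | dec-false (x <? x) (<-irrefl refl)
                           | dec-true (x ≟ x) refl = refl
... | tri> _ x≢K K<x rewrite dec-false (x <? suc K) (<⇒≱ K<x ∘ s≤s⁻¹) | dec-false (x <? K) (<-asym K<x)
                           | dec-false (x ≟ K) x≢K = refl

count-reindex : ∀ Q (h g : ℕ → ℕ) m K →
  (∀ p → p < K → Q p ≡ true → g p < m × h (g p) ≡ p) →
  (∀ j → j < m → h j < K → Q (h j) ≡ true) →
  (∀ j j′ → j < m → j′ < m → h j ≡ h j′ → j ≡ j′) →
  count Q K ≡ count (λ j → does (h j <? K)) m
count-reindex Q h g m zero    _    _    _   = sym (count-none _ m (λ j _ → dec-false (h j <? 0) λ ()))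
count-reindex Q h g m (suc K) back into inj = begin
  count Q K + indicator (Q K)
    ≡⟨ cong₂ _+_ (count-reindex Q h g m K (λ p → back p ∘ m<n⇒m<1+n) (λ j j<m → into j j<m ∘ m<n⇒m<1+n) inj) hits ⟩
  count (λ j → does (h j <? K)) m + count (λ j → does (h j ≟ K)) m
    ≡⟨ count-+ _ _ _ m (λ j _ → indicator-<-suc (h j) K) ⟨
  count (λ j → does (h j <? suc K)) m ∎
  where
  open ≡-Reasoning
  hits : indicator (Q K) ≡ count (λ j → does (h j ≟ K)) m
  hits with Q K in QK
  ... | true  = let gK<m , hgK≡K = back K ≤-refl QK in
    sym (count-unique _ m (g K) gK<m (dec-true (h (g K) ≟ K) hgK≡K)
          (λ j j<m hj≡K → inj j (g K) j<m gK<m (trans (dec-true⁻¹ (h j ≟ K) hj≡K) (sym hgK≡K))))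
  ... | false = sym (count-none _ m miss)
    where
    miss : ∀ j → j < m → does (h j ≟ K) ≡ false
    miss j j<m = dec-false (h j ≟ K) λ { refl → case trans (sym (into j j<m ≤-refl)) QK of λ () }

length-filter-applyUpTo : ∀ {P : ℕ → Set} (P? : Decidable P) f m →
  length (filter P? (applyUpTo f m)) ≡ count (λ q → does (P? (f q))) m
length-filter-applyUpTo P? f zero    = refl
length-filter-applyUpTo P? f (suc m) = begin
  length (filter P? (applyUpTo f (suc m)))                ≡⟨ cong (length ∘ filter P?) (applyUpTo-∷ʳ f m) ⟨
  length (filter P? (applyUpTo f m ++ [ f m ]))           ≡⟨ cong length (filter-++ P? (applyUpTo f m) [ f m ]) ⟩
  length (filter P? (applyUpTo f m) ++ filter P? [ f m ]) ≡⟨ length-++ (filter P? (applyUpTo f m)) ⟩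
  length (filter P? (applyUpTo f m)) + length (filter P? [ f m ])
    ≡⟨ cong₂ _+_ (length-filter-applyUpTo P? f m) (length-filter-singleton (f m)) ⟩
  count (λ q → does (P? (f q))) (suc m) ∎
  where
  open ≡-Reasoning
  length-filter-singleton : ∀ x → length (filter P? [ x ]) ≡ indicator (does (P? x))
  length-filter-singleton x with does (P? x)
  ... | true  = refl
  ... | false = refl

<?-suc : ∀ {x K} → x ≢ K → does (x <? suc K) ≡ does (x <? K)
<?-suc {x} {K} x≢K with <-cmp x K
... | tri< x<K _ _ = trans (dec-true (x <? suc K) (m<n⇒m<1+n x<K)) (sym (dec-true (x <? K) x<K))
... | tri≈ _ x≡K _ = ⊥-elim (x≢K x≡K)
... | tri> _ _ K<x = trans (dec-false (x <? suc K) (<⇒≱ K<x ∘ s≤s⁻¹)) (sym (dec-false (x <? K) (<-asym K<x)))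

below : ℕ → List ℕ → List ℕ
below K = filter (_<? K)

below-suc : ∀ {K xs} → All (_≢ K) xs → below (suc K) xs ≡ below K xs
below-suc                  []           = refl
below-suc {K} {x ∷ xs} (x≢K ∷ xs≢K) with x <? K
... | yes x<K = begin
  below (suc K) (x ∷ xs) ≡⟨ filter-accept (_<? suc K) (m<n⇒m<1+n x<K) ⟩
  x ∷ below (suc K) xs   ≡⟨ cong (x ∷_) (below-suc xs≢K) ⟩
  x ∷ below K xs         ≡⟨ filter-accept (_<? K) x<K ⟨
  below K (x ∷ xs)       ∎
  where open ≡-Reasoning
... | no  x≮K = begin
  below (suc K) (x ∷ xs) ≡⟨ filter-reject (_<? suc K) (λ x<sK → x≮K (≤∧≢⇒< (s≤s⁻¹ x<sK) x≢K)) ⟩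
  below (suc K) xs       ≡⟨ below-suc xs≢K ⟩
  below K xs             ≡⟨ filter-reject (_<? K) x≮K ⟨
  below K (x ∷ xs)       ∎
  where open ≡-Reasoning

module _ {K u : ℕ} (u<K : u < K) (xs ys : List ℕ) where

  below-suc-around : All (_≢ K) xs → All (_≢ K) ys →
                     below (suc K) (xs ++ u ∷ K ∷ ys) ≡ below K xs ++ u ∷ K ∷ below K ys
  below-suc-around xs≢K ys≢K = begin
    below (suc K) (xs ++ u ∷ K ∷ ys)                      ≡⟨ filter-++ (_<? suc K) xs _ ⟩
    below (suc K) xs ++ below (suc K) (u ∷ K ∷ ys)        ≡⟨ cong₂ _++_ (below-suc xs≢K)
                                                               (filter-accept (_<? suc K) (m<n⇒m<1+n u<K)) ⟩
    below K xs ++ u ∷ below (suc K) (K ∷ ys)              ≡⟨ cong (λ l → below K xs ++ u ∷ l)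
                                                               (filter-accept (_<? suc K) ≤-refl) ⟩
    below K xs ++ u ∷ K ∷ below (suc K) ys                ≡⟨ cong (λ l → below K xs ++ u ∷ K ∷ l) (below-suc ys≢K) ⟩
    below K xs ++ u ∷ K ∷ below K ys                      ∎
    where open ≡-Reasoning

  below-around : below K (xs ++ u ∷ K ∷ ys) ≡ below K xs ++ u ∷ below K ys
  below-around = begin
    below K (xs ++ u ∷ K ∷ ys)           ≡⟨ filter-++ (_<? K) xs _ ⟩
    below K xs ++ below K (u ∷ K ∷ ys)   ≡⟨ cong (below K xs ++_) (filter-accept (_<? K) u<K) ⟩
    below K xs ++ u ∷ below K (K ∷ ys)   ≡⟨ cong (λ l → below K xs ++ u ∷ l) (filter-reject (_<? K) (<-irrefl refl)) ⟩
    below K xs ++ u ∷ below K ys         ∎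
    where open ≡-Reasoning

iterate-applyUpTo : ∀ {A : Set} (f : A → A) (g : ℕ → A) → (∀ p → f (g p) ≡ g (suc p)) →
                    ∀ m → iterate f (g 0) m ≡ applyUpTo g m
iterate-applyUpTo f g step zero    = refl
iterate-applyUpTo f g step (suc m) =
  cong (g 0 ∷_) (trans (cong (λ x → iterate f x m) (step 0)) (iterate-applyUpTo f (g ∘ suc) (step ∘ suc) m))

applyUpTo-++ : ∀ {A : Set} (g : ℕ → A) m m′ → applyUpTo g (m + m′) ≡ applyUpTo g m ++ applyUpTo (g ∘ (m +_)) m′
applyUpTo-++ g zero    m′ = refl
applyUpTo-++ g (suc m) m′ = cong (g 0 ∷_) (applyUpTo-++ (g ∘ suc) m m′)

splice : ∀ X Y {V₁ V₀ : List Letter} {E} → V₁ ≡ X ++ a ∷ c ∷ Y → V₀ ≡ X ++ b ∷ Y → E ≡ suc (length X) →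
         (V₁ ! (E ∸ 1) ≡ just a) × (V₁ ! E ≡ just c) × (V₀ ≡ take (E ∸ 1) V₁ ++ b ∷ drop (suc E) V₁)
splice []      Y refl refl refl = refl , refl , refl
splice (x ∷ X) Y refl refl refl with p , q , r ← splice X Y refl refl refl = p , q , cong (x ∷_) r

firstReturn-head : ∀ fuel f K x m {z zs} → m ≤ fuel → below K (iterate f (f x) m) ≡ z ∷ zs →
                   firstReturn fuel f K x ≡ z
firstReturn-head fuel       f K x zero    _            ()
firstReturn-head (suc fuel) f K x (suc m) (s≤s m≤fuel) eq with f x <ᵇ K
... | true  = proj₁ (∷-injective eq)
... | false = firstReturn-head fuel f K (f x) m m≤fuel eq

below-iterate-tail : ∀ f K x m {z zs} → below K (iterate f x m) ≡ z ∷ zs →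
                     ∃[ m′ ] m′ < m × zs ≡ below K (iterate f (f z) m′)
below-iterate-tail f K x (suc m) eq with x <ᵇ K
... | true  with refl , refl ← ∷-injective eq = m , ≤-refl , refl
... | false = let m′ , m′<m , zs≡ = below-iterate-tail f K (f x) m eq in m′ , m<n⇒m<1+n m′<m , zs≡

iterate-firstReturn : ∀ fuel f K x m t → m ≤ fuel → t ≤ length (below K (iterate f (f x) m)) →
  iterate (firstReturn fuel f K) x (suc t) ≡ x ∷ take t (below K (iterate f (f x) m))
iterate-firstReturn fuel f K x m zero    _      _ = refl
iterate-firstReturn fuel f K x m (suc t) m≤fuel t<len with below K (iterate f (f x) m) in eq
... | z ∷ zs with m′ , m′<m , refl ← below-iterate-tail f K (f x) m eq =
  cong (x ∷_) (begin
    iterate (firstReturn fuel f K) (firstReturn fuel f K x) (suc t)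
      ≡⟨ cong (λ y → iterate (firstReturn fuel f K) y (suc t)) (firstReturn-head fuel f K x m m≤fuel eq) ⟩
    iterate (firstReturn fuel f K) z (suc t)
      ≡⟨ iterate-firstReturn fuel f K z m′ t (≤-trans (<⇒≤ m′<m) m≤fuel) (s≤s⁻¹ t<len) ⟩
    z ∷ take t zs ∎)
  where open ≡-Reasoning

iterate-cyclicRestriction : ∀ N f K → length (below (suc K) (iterate f 0 (suc N))) ≡ suc K →
  iterate (cyclicRestriction (suc N) f (suc K)) 0 (suc K) ≡ below (suc K) (iterate f 0 (suc N))
iterate-cyclicRestriction N f K len =
  trans (iterate-firstReturn (suc N) f (suc K) 0 N K (n≤1+n N) (≤-reflexive (sym len′)))
        (cong (0 ∷_) (take-all K _ (≤-reflexive len′)))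
  where
  len′ : length (below (suc K) (iterate f (f 0) N)) ≡ K
  len′ = suc-injective len

module _ {γ i : ℕ} (i<γ : i < γ) where

  private
    γ∸i≡1+γ∸1+i : γ ∸ i ≡ suc (γ ∸ suc i)
    γ∸i≡1+γ∸1+i = +-∸-assoc 1 i<γ

  ℓ-last-a : ℓ γ i (γ ∸ suc i) ≡ a
  ℓ-last-a rewrite γ∸i≡1+γ∸1+i | dec-true (γ ∸ suc i <? suc (γ ∸ suc i)) ≤-refl = refl

  ℓ-suc-last-b : ℓ γ (suc i) (γ ∸ suc i) ≡ b
  ℓ-suc-last-b rewrite dec-false (γ ∸ suc i <? γ ∸ suc i) (<-irrefl refl)
                     | dec-true (γ ∸ suc i <? γ) (subst (_≤ γ) γ∸i≡1+γ∸1+i (m∸n≤m γ i)) = refl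

  ℓ-suc : ∀ {x} → x ≢ γ ∸ suc i → ℓ γ i x ≡ ℓ γ (suc i) x
  ℓ-suc {x} x≢ rewrite γ∸i≡1+γ∸1+i | <?-suc x≢ = refl

ℓ-≥ : ∀ γ i {x} → γ ≤ x → ℓ γ i x ≡ c
ℓ-≥ γ i {x} γ≤x rewrite dec-false (x <? γ ∸ i) (≤⇒≯ (≤-trans (m∸n≤m γ i) γ≤x))
                      | dec-false (x <? γ) (≤⇒≯ γ≤x) = refl

module _ {d : ℕ} .{{_ : NonZero d}} where

  [m%d*n]%d≡[m*n]%d : ∀ m n → ((m % d) * n) % d ≡ (m * n) % d
  [m%d*n]%d≡[m*n]%d m n = begin
    ((m % d) * n) % d           ≡⟨ %-distribˡ-* (m % d) n d ⟩
    ((m % d % d) * (n % d)) % d ≡⟨ cong (λ t → (t * (n % d)) % d) (m%n%n≡m%n m d) ⟩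
    ((m % d) * (n % d)) % d     ≡⟨ %-distribˡ-* m n d ⟨
    (m * n) % d                 ∎
    where open ≡-Reasoning

  [m+n%d]%d≡[m+n]%d : ∀ m n → (m + n % d) % d ≡ (m + n) % d
  [m+n%d]%d≡[m+n]%d m n = begin
    (m + n % d) % d             ≡⟨ %-distribˡ-+ m (n % d) d ⟩
    (m % d + (n % d % d)) % d   ≡⟨ cong (λ t → (m % d + t) % d) (m%n%n≡m%n n d) ⟩
    (m % d + n % d) % d         ≡⟨ %-distribˡ-+ m n d ⟨
    (m + n) % d                 ∎
    where open ≡-Reasoning

  [[m*n]%d*o]%d≡m%d : ∀ m n o → (n * o) % d ≡ 1 → (((m * n) % d) * o) % d ≡ m % d
  [[m*n]%d*o]%d≡m%d m n o no≡1 = begin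
    (((m * n) % d) * o) % d   ≡⟨ [m%d*n]%d≡[m*n]%d (m * n) o ⟩
    (m * n * o) % d           ≡⟨ cong (_% d) (*-assoc m n o) ⟩
    (m * (n * o)) % d         ≡⟨ %-distribˡ-* m (n * o) d ⟩
    ((m % d) * ((n * o) % d)) % d ≡⟨ cong (λ t → ((m % d) * t) % d) no≡1 ⟩
    ((m % d) * 1) % d         ≡⟨ cong (_% d) (*-identityʳ (m % d)) ⟩
    m % d % d                 ≡⟨ m%n%n≡m%n m d ⟩
    m % d                     ∎
    where open ≡-Reasoning

  [m+n]%d≡0⇒m%d≡d∸n : ∀ m n → (m + n) % d ≡ 0 → 0 < n → n < d → m % d ≡ d ∸ n
  [m+n]%d≡0⇒m%d≡d∸n m n m+n≡0 0<n n<d = begin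
    m % d                 ≡⟨ m+n∸n≡m (m % d) n ⟨
    m % d + n ∸ n         ≡⟨ cong (_∸ n) (≤-antisym (m∸n≡0⇒m≤n r+n∸d≡0) d≤r+n) ⟩
    d ∸ n                 ∎
    where
    open ≡-Reasoning
    r+n%d≡0 : (m % d + n) % d ≡ 0
    r+n%d≡0 = trans (cong (_% d) (+-comm (m % d) n))
               (trans ([m+n%d]%d≡[m+n]%d n m) (trans (cong (_% d) (+-comm n m)) m+n≡0))
    d≤r+n : d ≤ m % d + n
    d≤r+n with d ≤? m % d + n
    ... | yes d≤ = d≤
    ... | no  d≰ = ⊥-elim (<⇒≢ (≤-trans 0<n (m≤n+m n (m % d))) (sym (trans (sym (m<n⇒m%n≡m (≰⇒> d≰))) r+n%d≡0)))
    r+n∸d≡0 : m % d + n ∸ d ≡ 0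
    r+n∸d≡0 = trans (sym (m<n⇒m%n≡m r+n∸d<d)) (trans (m≤n⇒[n∸m]%m≡n%m d≤r+n) r+n%d≡0)
      where
      r+n∸d<d : m % d + n ∸ d < d
      r+n∸d<d = <-≤-trans (∸-monoˡ-< (+-mono-< (m%n<n m d) n<d) d≤r+n) (≤-reflexive (m+n∸n≡m d d))

  [m+n]%d≡m+n : ∀ {m n} → m < d → n ≤ (m + n) % d → (m + n) % d ≡ m + n
  [m+n]%d≡m+n {m} {n} m<d n≤r with m + n <? d
  ... | yes m+n<d = m<n⇒m%n≡m m+n<d
  ... | no  m+n≮d = ⊥-elim (<⇒≱ r<n n≤r)
    where
    d≤m+n : d ≤ m + n
    d≤m+n = ≮⇒≥ m+n≮d
    r<n : (m + n) % d < n
    r<n = begin-strict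
      (m + n) % d       ≡⟨ m≤n⇒[n∸m]%m≡n%m d≤m+n ⟨
      (m + n ∸ d) % d   ≤⟨ m%n≤m (m + n ∸ d) d ⟩
      m + n ∸ d         <⟨ ∸-monoˡ-< (+-monoˡ-< n m<d) d≤m+n ⟩
      d + n ∸ d         ≡⟨ m+n∸m≡n d n ⟩
      n                 ∎
      where open ≤-Reasoning

-- γ = suc γ′ makes N = γ + ρ visibly nonzero, so that mod reduces to _%_.
module Orbit (γ′ ρ γ* : ℕ) (γ*<N : γ* < suc γ′ + ρ) (γγ*≡1 : (suc γ′ * γ*) mod (suc γ′ + ρ) ≡ 1) where

  γ N : ℕ
  γ = suc γ′
  N = γ + ρ

  orbit : ℕ → ℕ
  orbit p = (p * ρ) % N

  orbit<N : ∀ p → orbit p < N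
  orbit<N p = m%n<n (p * ρ) N

  orbit-suc : ∀ p → σ γ ρ (orbit p) ≡ orbit (suc p)
  orbit-suc p = trans (cong (_% N) (+-comm (orbit p) ρ)) ([m+n%d]%d≡[m+n]%d ρ (p * ρ))

  -- ρ ≡ -γ modulo N, so N - γ* inverts ρ.
  ρ⁻¹ : ℕ
  ρ⁻¹ = N ∸ γ*

  ρρ⁻¹≡1 : (ρ * ρ⁻¹) % N ≡ 1
  ρρ⁻¹≡1 = begin
    (ρ * ρ⁻¹) % N                   ≡⟨ [m+kn]%n≡m%n (ρ * ρ⁻¹) γ* N ⟨
    (ρ * ρ⁻¹ + γ* * N) % N          ≡⟨ cong (_% N) (solve 4 (λ r s g g* → r :* s :+ g* :* (g :+ r) := g* :* g :+ r :* (s :+ g*))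
                                                         refl ρ ρ⁻¹ γ γ*) ⟩
    (γ* * γ + ρ * (ρ⁻¹ + γ*)) % N   ≡⟨ cong (λ t → (γ* * γ + ρ * t) % N) (m∸n+n≡m (<⇒≤ γ*<N)) ⟩
    (γ* * γ + ρ * N) % N            ≡⟨ [m+kn]%n≡m%n (γ* * γ) ρ N ⟩
    (γ* * γ) % N                    ≡⟨ cong (_% N) (*-comm γ* γ) ⟩
    (γ * γ*) % N                    ≡⟨ γγ*≡1 ⟩
    1                               ∎
    where open ≡-Reasoning

  time : ℕ → ℕ
  time x = (x * ρ⁻¹) % N

  time-orbit : ∀ {p} → p < N → time (orbit p) ≡ p
  time-orbit {p} p<N = trans ([[m*n]%d*o]%d≡m%d p ρ ρ⁻¹ ρρ⁻¹≡1) (m<n⇒m%n≡m p<N)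

  orbit-time : ∀ {x} → x < N → orbit (time x) ≡ x
  orbit-time {x} x<N = trans ([[m*n]%d*o]%d≡m%d x ρ⁻¹ ρ (trans (cong (_% N) (*-comm ρ⁻¹ ρ)) ρρ⁻¹≡1)) (m<n⇒m%n≡m x<N)

  orbit-injective : ∀ {p q} → p < N → q < N → orbit p ≡ orbit q → p ≡ q
  orbit-injective p<N q<N eq = trans (sym (time-orbit p<N)) (trans (cong time eq) (time-orbit q<N))

  -- the time at which the orbit of 0 reaches N - j, as it occurs in d and e
  τ : ℕ → ℕ
  τ j = (j * γ*) % N

  τ<N : ∀ j → τ j < N
  τ<N j = m%n<n (j * γ*) N

  -- jγ*ρ ≡ -jγ*γ ≡ -j modulo N
  orbit-τ : ∀ {j} → 0 < j → j < N → orbit (τ j) ≡ N ∸ j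
  orbit-τ {j} 0<j j<N =
    trans ([m%d*n]%d≡[m*n]%d (j * γ*) ρ) ([m+n]%d≡0⇒m%d≡d∸n (j * γ* * ρ) j jγ*ρ+j≡0 0<j j<N)
    where
    open ≡-Reasoning
    jγγ*≡j : (j * (γ * γ*)) % N ≡ j % N
    jγγ*≡j = begin
      (j * (γ * γ*)) % N              ≡⟨ %-distribˡ-* j (γ * γ*) N ⟩
      ((j % N) * ((γ * γ*) % N)) % N  ≡⟨ cong (λ t → ((j % N) * t) % N) γγ*≡1 ⟩
      ((j % N) * 1) % N               ≡⟨ cong (_% N) (*-identityʳ (j % N)) ⟩
      j % N % N                       ≡⟨ m%n%n≡m%n j N ⟩
      j % N                           ∎
    jγ*ρ+j≡0 : (j * γ* * ρ + j) % N ≡ 0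
    jγ*ρ+j≡0 = begin
      (j * γ* * ρ + j) % N                  ≡⟨ [m+n%d]%d≡[m+n]%d (j * γ* * ρ) j ⟨
      (j * γ* * ρ + j % N) % N              ≡⟨ cong (λ t → (j * γ* * ρ + t) % N) jγγ*≡j ⟨
      (j * γ* * ρ + (j * (γ * γ*)) % N) % N ≡⟨ [m+n%d]%d≡[m+n]%d (j * γ* * ρ) (j * (γ * γ*)) ⟩
      (j * γ* * ρ + j * (γ * γ*)) % N       ≡⟨ cong (_% N) (solve 4 (λ x g* r g → x :* g* :* r :+ x :* (g :* g*) := (x :* g*) :* (g :+ r))
                                                               refl j γ* ρ γ) ⟩
      ((j * γ*) * N) % N                    ≡⟨ m*n%n≡0 (j * γ*) N ⟩
      0                                     ∎

  τ-injective : ∀ {j j′} → 0 < j → j < N → 0 < j′ → j′ < N → τ j ≡ τ j′ → j ≡ j′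
  τ-injective 0<j j<N 0<j′ j′<N eq =
    ∸-cancelˡ-≡ (<⇒≤ j<N) (<⇒≤ j′<N) (trans (sym (orbit-τ 0<j j<N)) (trans (cong orbit eq) (orbit-τ 0<j′ j′<N)))

  τ-complement : ∀ {p} → p < N → 0 < orbit p → τ (N ∸ orbit p) ≡ p
  τ-complement {p} p<N 0<orbit = orbit-injective (τ<N (N ∸ orbit p)) p<N (begin
    orbit (τ (N ∸ orbit p)) ≡⟨ orbit-τ (m<n⇒0<n∸m (orbit<N p)) (∸-monoʳ-< 0<orbit (<⇒≤ (orbit<N p))) ⟩
    N ∸ (N ∸ orbit p)       ≡⟨ m∸[m∸n]≡n (<⇒≤ (orbit<N p)) ⟩
    orbit p                 ∎)
    where open ≡-Reasoning

  orbitList : List ℕ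
  orbitList = applyUpTo orbit N

  iterate-σ : iterate (σ γ ρ) 0 N ≡ orbitList
  iterate-σ = iterate-applyUpTo (σ γ ρ) orbit orbit-suc N

  length-below-orbitList : ∀ {K} → K ≤ N → length (below K orbitList) ≡ K
  length-below-orbitList {K} K≤N = begin
    length (below K orbitList)           ≡⟨ length-filter-applyUpTo (_<? K) orbit N ⟩
    count (λ p → does (orbit p <? K)) N  ≡⟨ count-reindex _ time orbit K N back into inj ⟩
    count (λ j → does (time j <? N)) K   ≡⟨ count-all _ K (λ j _ → dec-true (time j <? N) (m%n<n (j * ρ⁻¹) N)) ⟩
    K                                    ∎
    where
    open ≡-Reasoning
    back : ∀ p → p < N → does (orbit p <? K) ≡ true → orbit p < K × time (orbit p) ≡ p
    back p p<N orbit<K = dec-true⁻¹ (orbit p <? K) orbit<K , time-orbit p<N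
    into : ∀ j → j < K → time j < N → does (orbit (time j) <? K) ≡ true
    into j j<K _ = dec-true (orbit (time j) <? K) (subst (_< K) (sym (orbit-time (<-≤-trans j<K K≤N))) j<K)
    inj : ∀ j j′ → j < K → j′ < K → time j ≡ time j′ → j ≡ j′
    inj j j′ j<K j′<K eq =
      trans (sym (orbit-time (<-≤-trans j<K K≤N))) (trans (cong orbit eq) (orbit-time (<-≤-trans j′<K K≤N)))

  iterate-σₙ : ∀ {m} → m < N → iterate (σₙ γ ρ m) 0 (suc m) ≡ below (suc m) orbitList
  iterate-σₙ {m} m<N = begin
    iterate (σₙ γ ρ m) 0 (suc m)              ≡⟨ iterate-cyclicRestriction (γ′ + ρ) (σ γ ρ) m len ⟩
    below (suc m) (iterate (σ γ ρ) 0 N)       ≡⟨ cong (below (suc m)) iterate-σ ⟩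
    below (suc m) orbitList                   ∎
    where
    open ≡-Reasoning
    len : length (below (suc m) (iterate (σ γ ρ) 0 N)) ≡ suc m
    len = trans (cong (length ∘ below (suc m)) iterate-σ) (length-below-orbitList m<N)

  -- In the paper's notation w = n + 1, i′ = i − 1 (the index of ℓ in v (n+1)) and u = γ − i.
  module Step (n : ℕ) (1+n<N : suc n < N) (ρ≤1+n : ρ ≤ suc n) (γ<ρ : γ < ρ) where

    w i′ u : ℕ
    w  = suc n
    i′ = γ′ + ρ ∸ w
    u  = γ ∸ suc i′

    w+1+i′≡N : w + suc i′ ≡ N
    w+1+i′≡N = trans (+-suc w i′) (cong suc (m+[n∸m]≡n (s≤s⁻¹ 1+n<N)))

    γ′+ρ∸n≡1+i′ : γ′ + ρ ∸ n ≡ suc i′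
    γ′+ρ∸n≡1+i′ = +-∸-assoc 1 (s≤s⁻¹ 1+n<N)

    i′<γ : i′ < γ
    i′<γ = s≤s (≤-trans (∸-monoʳ-≤ (γ′ + ρ) ρ≤1+n) (≤-reflexive (m+n∸n≡m γ′ ρ)))

    1+i′<N : suc i′ < N
    1+i′<N = subst (suc i′ <_) (trans (+-comm (suc i′) w) w+1+i′≡N) (m<m+n (suc i′) z<s)

    u+1+i′≡γ : u + suc i′ ≡ γ
    u+1+i′≡γ = m∸n+n≡m i′<γ

    u+ρ≡w : u + ρ ≡ w
    u+ρ≡w = +-cancelʳ-≡ (suc i′) (u + ρ) w (begin
      u + ρ + suc i′  ≡⟨ solve 3 (λ x y z → x :+ y :+ z := x :+ z :+ y) refl u ρ (suc i′) ⟩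
      u + suc i′ + ρ  ≡⟨ cong (_+ ρ) u+1+i′≡γ ⟩
      N               ≡⟨ w+1+i′≡N ⟨
      w + suc i′      ∎)
      where open ≡-Reasoning

    γ≤w : γ ≤ w
    γ≤w = ≤-trans (<⇒≤ γ<ρ) ρ≤1+n

    u<w : u < w
    u<w = <-≤-trans (subst (u <_) u+1+i′≡γ (m<m+n u z<s)) γ≤w

    1+w≤orbit-τ : ∀ {j} → j < i′ → suc w ≤ orbit (τ (suc j))
    1+w≤orbit-τ {j} j<i′ = begin
      suc w                 ≡⟨ m+n∸n≡m (suc w) i′ ⟨
      suc w + i′ ∸ i′       ≡⟨ cong (_∸ i′) (trans (sym (+-suc w i′)) w+1+i′≡N) ⟩
      N ∸ i′                ≤⟨ ∸-monoʳ-≤ N j<i′ ⟩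
      N ∸ suc j             ≡⟨ orbit-τ z<s (<-trans (s<s j<i′) 1+i′<N) ⟨
      orbit (τ (suc j))     ∎
      where open ≤-Reasoning

    orbit-τ[1+i′] : orbit (τ (suc i′)) ≡ w
    orbit-τ[1+i′] = trans (orbit-τ z<s 1+i′<N) (trans (cong (_∸ suc i′) (sym w+1+i′≡N)) (m+n∸n≡m w (suc i′)))

    k : ℕ
    k = pred (τ (suc i′))

    τ[1+i′]≡1+k : τ (suc i′) ≡ suc k
    τ[1+i′]≡1+k = sym (suc-pred (τ (suc i′)) {{≢-nonZero τ≢0}})
      where
      τ≢0 : τ (suc i′) ≢ 0
      τ≢0 τ≡0 = 0≢1+n (trans (sym (cong orbit τ≡0)) orbit-τ[1+i′])

    1+k<N : suc k < N
    1+k<N = subst (_< N) τ[1+i′]≡1+k (τ<N (suc i′))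

    k<N : k < N
    k<N = <-trans (n<1+n k) 1+k<N

    orbit-1+k : orbit (suc k) ≡ w
    orbit-1+k = trans (cong orbit (sym τ[1+i′]≡1+k)) orbit-τ[1+i′]

    orbit-k : orbit k ≡ u
    orbit-k = +-cancelʳ-≡ ρ (orbit k) u (begin
      orbit k + ρ         ≡⟨ [m+n]%d≡m+n (orbit<N k) (subst (ρ ≤_) (sym σ[orbit-k]≡w) ρ≤1+n) ⟨
      σ γ ρ (orbit k)     ≡⟨ σ[orbit-k]≡w ⟩
      w                   ≡⟨ u+ρ≡w ⟨
      u + ρ               ∎)
      where
      open ≡-Reasoning
      σ[orbit-k]≡w : σ γ ρ (orbit k) ≡ w
      σ[orbit-k]≡w = trans (orbit-suc k) orbit-1+k

    orbit-≢u : ∀ {p} → p < N → p ≢ k → orbit p ≢ u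
    orbit-≢u p<N p≢k eq = p≢k (orbit-injective p<N k<N (trans eq (sym orbit-k)))

    orbit-≢w : ∀ {p} → p < N → p ≢ suc k → orbit p ≢ w
    orbit-≢w p<N p≢1+k eq = p≢1+k (orbit-injective p<N 1+k<N (trans eq (sym orbit-1+k)))

    r : ℕ
    r = N ∸ suc (suc k)

    k+2+r≡N : k + suc (suc r) ≡ N
    k+2+r≡N = trans (+-suc k (suc r)) (trans (cong suc (+-suc k r)) (m+[n∸m]≡n 1+k<N))

    A B : List ℕ
    A = applyUpTo orbit k
    B = applyUpTo (λ q → orbit (k + suc (suc q))) r

    orbitList-split : orbitList ≡ A ++ u ∷ w ∷ B
    orbitList-split = begin
      applyUpTo orbit N                                       ≡⟨ cong (applyUpTo orbit) k+2+r≡N ⟨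
      applyUpTo orbit (k + suc (suc r))                       ≡⟨ applyUpTo-++ orbit k (suc (suc r)) ⟩
      A ++ orbit (k + 0) ∷ orbit (k + 1) ∷ B                  ≡⟨ cong₂ (λ x y → A ++ x ∷ y ∷ B)
                                                                   (trans (cong orbit (+-identityʳ k)) orbit-k)
                                                                   (trans (cong orbit (+-comm k 1)) orbit-1+k) ⟩
      A ++ u ∷ w ∷ B                                          ∎
      where open ≡-Reasoning

    Avoids : List ℕ → Set
    Avoids = All (λ x → x ≢ u × x ≢ w)

    A-avoids : Avoids A
    A-avoids = applyUpTo⁺₁ orbit k λ p<k →
      orbit-≢u (<-trans p<k k<N) (<⇒≢ p<k) , orbit-≢w (<-trans p<k k<N) (<⇒≢ (m<n⇒m<1+n p<k))

    B-avoids : Avoids B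
    B-avoids = applyUpTo⁺₁ _ r λ {q} q<r →
      let p<N = subst (k + suc (suc q) <_) k+2+r≡N (+-monoʳ-< k (s<s (s<s q<r)))
      in orbit-≢u p<N (>⇒≢ (m<m+n k z<s)) , orbit-≢w p<N (>⇒≢ (subst (suc k <_) (sym (+-suc k (suc q))) (s<s (m<m+n k z<s))))

    X Y : List ℕ
    X = below w A
    Y = below w B

    below-1+w : below (suc w) orbitList ≡ X ++ u ∷ w ∷ Y
    below-1+w = trans (cong (below (suc w)) orbitList-split)
                      (below-suc-around u<w A B (All.map proj₂ A-avoids) (All.map proj₂ B-avoids))

    below-w : below w orbitList ≡ X ++ u ∷ Y
    below-w = trans (cong (below w) orbitList-split) (below-around u<w A B)

    ℓ′ : ℕ → Letter
    ℓ′ = ℓ γ (suc i′)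

    ℓ-agree : ∀ {zs} → Avoids zs → map (ℓ γ i′) (below w zs) ≡ map ℓ′ (below w zs)
    ℓ-agree zs-avoids = map-cong-local (All.map (ℓ-suc i′<γ ∘ proj₁) (filter⁺ (_<? w) zs-avoids))

    v[1+n]≡ : v γ ρ (suc n) ≡ map ℓ′ X ++ a ∷ c ∷ map ℓ′ Y
    v[1+n]≡ = begin
      v γ ρ (suc n)                                               ≡⟨ cong (map (ℓ γ i′)) (trans (iterate-σₙ 1+n<N) below-1+w) ⟩
      map (ℓ γ i′) (X ++ u ∷ w ∷ Y)                               ≡⟨ map-++ (ℓ γ i′) X _ ⟩
      map (ℓ γ i′) X ++ ℓ γ i′ u ∷ ℓ γ i′ w ∷ map (ℓ γ i′) Y      ≡⟨ cong₂ _++_ (ℓ-agree A-avoids)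
                                                                       (cong₂ _∷_ (ℓ-last-a i′<γ) (cong₂ _∷_ (ℓ-≥ γ i′ γ≤w) (ℓ-agree B-avoids))) ⟩
      map ℓ′ X ++ a ∷ c ∷ map ℓ′ Y                                ∎
      where open ≡-Reasoning

    v[n]≡ : v γ ρ n ≡ map ℓ′ X ++ b ∷ map ℓ′ Y
    v[n]≡ = begin
      v γ ρ n                                  ≡⟨ cong₂ map (cong (ℓ γ) γ′+ρ∸n≡1+i′)
                                                            (trans (iterate-σₙ (<-trans (n<1+n n) 1+n<N)) below-w) ⟩
      map ℓ′ (X ++ u ∷ Y)                      ≡⟨ map-++ ℓ′ X _ ⟩
      map ℓ′ X ++ ℓ′ u ∷ map ℓ′ Y              ≡⟨ cong (λ x → map ℓ′ X ++ x ∷ map ℓ′ Y) (ℓ-suc-last-b i′<γ) ⟩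
      map ℓ′ X ++ b ∷ map ℓ′ Y                 ∎
      where open ≡-Reasoning

    below-1+w? : ℕ → Bool
    below-1+w? p = does (orbit p <? suc w)

    length-X : length X ≡ count below-1+w? k
    length-X = trans (cong length (sym (below-suc (All.map proj₂ A-avoids))))
                     (length-filter-applyUpTo (_<? suc w) orbit k)

    -- The times p < k at which the orbit is above w are the τ (j + 1), j < i′.
    count-above : count (not ∘ below-1+w?) k ≡ count (λ j → does (τ (suc j) <? k)) i′
    count-above = count-reindex _ (τ ∘ suc) (λ p → γ′ + ρ ∸ orbit p) i′ k back into inj
      where
      back : ∀ p → p < k → not (below-1+w? p) ≡ true → γ′ + ρ ∸ orbit p < i′ × τ (suc (γ′ + ρ ∸ orbit p)) ≡ p
      back p p<k above = subst (_≤ i′) (sym 1+γ′+ρ∸orbit≡N∸orbit) (∸-monoʳ-≤ N 1+w≤orbit)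
                       , trans (cong τ 1+γ′+ρ∸orbit≡N∸orbit) (τ-complement p<N (<-≤-trans z<s 1+w≤orbit))
        where
        p<N = <-trans p<k k<N
        1+w≤orbit : suc w ≤ orbit p
        1+w≤orbit = ≮⇒≥ (dec-true⁻¹ (¬? (orbit p <? suc w)) above)
        1+γ′+ρ∸orbit≡N∸orbit : suc (γ′ + ρ ∸ orbit p) ≡ N ∸ orbit p
        1+γ′+ρ∸orbit≡N∸orbit = sym (+-∸-assoc 1 (s≤s⁻¹ (orbit<N p)))
      into : ∀ j → j < i′ → τ (suc j) < k → not (below-1+w? (τ (suc j))) ≡ true
      into j j<i′ _ = dec-true (¬? (orbit (τ (suc j)) <? suc w)) (≤⇒≯ (1+w≤orbit-τ j<i′))
      inj : ∀ j j′ → j < i′ → j′ < i′ → τ (suc j) ≡ τ (suc j′) → j ≡ j′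
      inj j j′ j<i′ j′<i′ eq =
        suc-injective (τ-injective z<s (<-trans (s<s j<i′) 1+i′<N) z<s (<-trans (s<s j′<i′) 1+i′<N) eq)

    d≡count : d γ ρ γ* (suc i′) ≡ count (λ j → does (τ (suc j) <? k)) i′
    d≡count = begin
      length (filter (λ j → τ j <? τ (suc i′)) (map suc (upTo (suc i′))))
        ≡⟨ cong (length ∘ filter (λ j → τ j <? τ (suc i′))) (map-upTo suc (suc i′)) ⟩
      length (filter (λ j → τ j <? τ (suc i′)) (applyUpTo suc (suc i′)))
        ≡⟨ length-filter-applyUpTo (λ j → τ j <? τ (suc i′)) suc (suc i′) ⟩
      count (λ j → does (τ (suc j) <? τ (suc i′))) i′ + indicator (does (τ (suc i′) <? τ (suc i′)))
        ≡⟨ cong₂ _+_ (count-cong i′ λ j j<i′ → trans (cong (λ t → does (τ (suc j) <? t)) τ[1+i′]≡1+k)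
                                                     (<?-suc (τ≢k j<i′)))
                     (cong indicator (dec-false (τ (suc i′) <? τ (suc i′)) (<-irrefl refl))) ⟩
      count (λ j → does (τ (suc j) <? k)) i′ + 0
        ≡⟨ +-identityʳ _ ⟩
      count (λ j → does (τ (suc j) <? k)) i′ ∎
      where
      open ≡-Reasoning
      τ≢k : ∀ {j} → j < i′ → τ (suc j) ≢ k
      τ≢k j<i′ τ≡k =
        <⇒≱ (<-trans u<w (n<1+n w)) (subst (suc w ≤_) (trans (cong orbit τ≡k) orbit-k) (1+w≤orbit-τ j<i′))

    e≡ : e γ ρ γ* (suc i′) ≡ suc (length (map ℓ′ X))
    e≡ = begin
      τ (suc i′) ∸ d γ ρ γ* (suc i′)        ≡⟨ cong₂ _∸_ τ[1+i′]≡1+k (trans d≡count (sym count-above)) ⟩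
      suc k ∸ D                             ≡⟨ cong (λ t → suc t ∸ D) (count+count-not below-1+w? k) ⟨
      suc (count below-1+w? k + D) ∸ D      ≡⟨ m+n∸n≡m (suc (count below-1+w? k)) D ⟩
      suc (count below-1+w? k)              ≡⟨ cong suc (trans (sym length-X) (sym (length-map ℓ′ X))) ⟩
      suc (length (map ℓ′ X))               ∎
      where
      open ≡-Reasoning
      D = count (not ∘ below-1+w?) k

corollary15 : (γ ρ γ* : ℕ) → 0 < γ → γ < ρ → Coprime γ ρ →
    1 ≤ γ* → γ* < γ + ρ → (γ * γ*) mod (γ + ρ) ≡ 1 →
    (n : ℕ) → γ + ρ ∸ γ ∸ 1 ≤ n → n ≤ γ + ρ ∸ 2 →
      (v γ ρ (suc n) ! (e γ ρ γ* (γ + ρ ∸ 1 ∸ n) ∸ 1) ≡ just a)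
      × (v γ ρ (suc n) ! e γ ρ γ* (γ + ρ ∸ 1 ∸ n) ≡ just c)
      × (v γ ρ n ≡ take (e γ ρ γ* (γ + ρ ∸ 1 ∸ n) ∸ 1) (v γ ρ (suc n))
                     ++ b ∷ drop (suc (e γ ρ γ* (γ + ρ ∸ 1 ∸ n))) (v γ ρ (suc n)))
corollary15 (suc γ′) ρ γ* _ γ<ρ _ _ γ*<N γγ*≡1 n ρ∸1≤n n≤N∸2 =
  splice (map ℓ′ X) (map ℓ′ Y) v[1+n]≡ v[n]≡ (trans (cong (e γ ρ γ*) γ′+ρ∸n≡1+i′) e≡)
  where
  0<ρ : 0 < ρ
  0<ρ = <-trans z<s γ<ρ
  1+n<N : suc n < suc γ′ + ρ
  1+n<N = s≤s (≤-trans (s≤s n≤N∸2) (≤-reflexive (trans (+-comm 1 _) (m∸n+n≡m (≤-trans 0<ρ (m≤n+m ρ γ′))))))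
  ρ≤1+n : ρ ≤ suc n
  ρ≤1+n = ≤-trans (m≤n+m∸n ρ 1) (s≤s (subst (λ t → t ∸ 1 ≤ n) (m+n∸m≡n γ′ ρ) ρ∸1≤n))
  open Orbit γ′ ρ γ* γ*<N γγ*≡1
  open Step n 1+n<N ρ≤1+n γ<ρ
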